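{- Let $b\ge1$ and $k\ge0$ be integers, and let $A\subseteq\mathbb{N}$ with $\min(A)=0$ and $\max(A)\le k$. Let $f\in\mathcal{M}^b$ be the element with set-array representation $(A,\emptyset,\ldots,\emptyset)$. Then $d(f)\le d([k]_b)$, and the inequality is strict for $f\neq[k]_b$.
   Context: $\mathbb{N}=\{0,1,2,\ldots\}$, $[k]=\{0,\ldots,k\}$, $X+Y=\{x+y:x\in X,y\in Y\}$, $X+\emptyset=\emptyset$. $\mathcal{M}^b$ is the set of functions $f:\mathbb{N}\to\{0,\ldots,b\}$ with finite support; the set-array representation of $f$ is $(A_1,\ldots,A_b)$ with $A_i=\{a:f(a)\ge i\}$, which determines $f$. The sum of $f,g\in\mathcal{M}^b$ with set arrays $(A_i),(B_i)$ is the element with set array $(A_1+B_1,\ldots,A_b+B_b)$. $g\in\mathcal{M}^b$ is a divisor of $f$ if $f=g+h$ for some $h\in\mathcal{M}^b$; $d(f)$ (for $f$ not identically $0$) is the number of divisors of $f$. $[k]_b$ is the element of $\mathcal{M}^b$ with set array $([k],\emptyset,\ldots,\emptyset)$. -}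

module Defs where

open import Data.Nat using (ℕ; zero; suc; _+_; _≤_; _≤ᵇ_; s≤s)
open import Data.Fin using (Fin; toℕ; fromℕ<) renaming (zero to fzero)
open import Data.Bool using (Bool; true; false; if_then_else_)
open import Data.Product using (Σ; ∃; ∃-syntax; _×_)
open import Relation.Binary.PropositionalEquality using (_≡_)
open import Function.Bundles using (_⇔_)

-- Elements of 𝓜^b are functions ℕ → {0,…,b} (values in Fin (suc b))
-- with finite support.
Fun : ℕ → Set
Fun b = ℕ → Fin (suc b)

FinSupp : ∀ {b} → Fun b → Set
FinSupp f = ∃[ N ] (∀ n → N ≤ n → f n ≡ fzero)

InM : ∀ {b} → Fun b → Set
InM f = FinSupp f

_≈_ : ∀ {b} → Fun b → Fun b → Set
f ≈ g = ∀ n → f n ≡ g n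

-- a ∈ A_i(f), where (A_1,…,A_b) is the set-array representation of f.
Level : ∀ {b} → Fun b → ℕ → ℕ → Set
Level f i a = i ≤ toℕ (f a)

InSumset : ∀ {b} → Fun b → Fun b → ℕ → ℕ → Set
InSumset g h i n = ∃[ x ] ∃[ y ] (x + y ≡ n × Level g i x × Level h i y)

IsSum : ∀ {b} → Fun b → Fun b → Fun b → Set
IsSum {b} f g h = ∀ i → 1 ≤ i → i ≤ b → ∀ n → (Level f i n ⇔ InSumset g h i n)

IsDivisor : ∀ {b} → Fun b → Fun b → Set
IsDivisor g f = InM g × ∃[ h ] (InM h × IsSum f g h)

DivisorCount : ∀ {b} → Fun b → ℕ → Set
DivisorCount {b} f m =
  Σ (Fin m → Fun b) λ e →
    (∀ i → IsDivisor (e i) f) ×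
    (∀ i j → e i ≈ e j → i ≡ j) ×
    (∀ g → IsDivisor g f → ∃[ i ] (g ≈ e i))

one : ∀ {b} → 1 ≤ b → Fin (suc b)
one p = fromℕ< (s≤s p)

-- Element with set array (A, ∅, …, ∅) for A ⊆ ℕ given by its indicator.
single : ∀ {b} → 1 ≤ b → (ℕ → Bool) → Fun b
single p A n = if A n then one p else fzero

interval : ∀ {b} → 1 ≤ b → ℕ → Fun b
interval p k = single p (λ n → n ≤ᵇ k)

-- A divisor g of f, with cofactor h, satisfies 0 ∈ supp g ⊆ A, and since m + y ∈ A ⊆ [0, k]
-- for m = max supp g and every y ∈ supp h, the support of h lies in [0, k - m]. Giving g the
-- value 1 at every point of [0, m] outside A therefore yields a divisor of [k] (with cofactor
-- [k - m]); g is the restriction of this filling to A, so the filling is injective on divisors.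
-- A filling has its maximum in A, so it never equals [j] for j ∈ [0, k] outside A, which
-- makes the inequality strict when A ≠ [0, k]. Both divisor sets are finite because divisors
-- are supported in [0, k], where they can be coded by Fin ((b + 1) ^ (k + 1)).
module Submission where

open import Defs
open import Data.Nat using (ℕ; _≤_; _<_)
open import Data.Bool using (Bool; true)
open import Data.Product using (∃-syntax; _×_)
open import Relation.Binary.PropositionalEquality using (_≡_)
open import Relation.Nullary using (¬_)

open import Data.Nat using (zero; suc; _+_; _∸_; _^_; _≤ᵇ_; z≤n; s≤s; s≤s⁻¹)
open import Data.Nat.Properties
open import Data.Bool using (false; if_then_else_)
open import Data.Bool.Properties using (T-≡; ¬-not) renaming (_≟_ to _≟ᵇ_)
open import Data.Fin as Fin using (Fin; toℕ; finToFun; funToFin; combine; punchOut)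
  renaming (zero to fzero)
open import Data.Fin.Properties as Finₚ
  using (any?; injective⇒≤; punchOut-injective; funToFin-finToFin; finToFun-funToFin)
open import Data.Product using (Σ; _,_; proj₁; proj₂)
open import Data.Sum using (inj₁; inj₂)
open import Function using (_∘_)
open import Function.Bundles using (_⇔_; mk⇔; Equivalence)
open import Function.Definitions using (Injective)
open import Relation.Binary.PropositionalEquality
  using (refl; sym; trans; cong; cong₂; subst; _≢_; module ≡-Reasoning)
open import Relation.Nullary using (Dec; yes; no; contradiction; _×-dec_; _→-dec_)
open import Relation.Nullary.Decidable using (map′)
open import Relation.Unary using (Decidable)

Bounded : ∀ {b} → ℕ → Fun b → Set
Bounded k g = ∀ n → k < n → g n ≡ fzero

fzero⇒¬Level : ∀ {b} {g : Fun b} {i x} → 1 ≤ i → g x ≡ fzero → ¬ Level g i x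
fzero⇒¬Level {i = i} 1≤i gx≡0 l = <⇒≱ 1≤i (subst (λ v → i ≤ toℕ v) gx≡0 l)

1≰toℕ⇒fzero : ∀ {b} (v : Fin (suc b)) → ¬ 1 ≤ toℕ v → v ≡ fzero
1≰toℕ⇒fzero fzero _ = refl
1≰toℕ⇒fzero (Fin.suc v) ¬l = contradiction (s≤s z≤n) ¬l

Bounded-Level⇒≤ : ∀ {b k} {g : Fun b} {i x} → Bounded k g → 1 ≤ i → Level g i x → x ≤ k
Bounded-Level⇒≤ {g = g} bd 1≤i l = ≮⇒≥ (λ k<x → fzero⇒¬Level {g = g} 1≤i (bd _ k<x) l)

Bounded⇒InM : ∀ {b k} {g : Fun b} → Bounded k g → InM g
Bounded⇒InM {k = k} bd = suc k , bd

Level-resp : ∀ {b} {g g' : Fun b} {i x} → g ≈ g' → Level g i x → Level g' i x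
Level-resp {i = i} {x} g≈g' = subst (λ v → i ≤ toℕ v) (g≈g' x)

InSumset-resp : ∀ {b} {g g' h h' : Fun b} {i n} → g ≈ g' → h ≈ h' →
                InSumset g h i n → InSumset g' h' i n
InSumset-resp g≈g' h≈h' (x , y , x+y≡n , lg , lh) =
  x , y , x+y≡n , Level-resp g≈g' lg , Level-resp h≈h' lh

IsSum-resp : ∀ {b} {f g g' h h' : Fun b} → g ≈ g' → h ≈ h' → IsSum f g h → IsSum f g' h'
IsSum-resp g≈g' h≈h' S i 1≤i i≤b n = mk⇔
  (InSumset-resp g≈g' h≈h' ∘ to)
  (from ∘ InSumset-resp (sym ∘ g≈g') (sym ∘ h≈h'))
  where open Equivalence (S i 1≤i i≤b n)

IsDivisor-resp : ∀ {b} {f g g' : Fun b} → g ≈ g' → IsDivisor g f → IsDivisor g' f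
IsDivisor-resp g≈g' ((N , vanish) , h , h∈M , S) =
  (N , λ n N≤n → trans (sym (g≈g' n)) (vanish n N≤n)) , h , h∈M , IsSum-resp g≈g' (λ _ → refl) S

-- Finiteness of the set of divisors

Enumeration : ∀ {N} → (Fin N → Set) → ℕ → Set
Enumeration {N} P m =
  Σ (Fin m → Fin N) λ e → (∀ i → P (e i)) × Injective _≡_ _≡_ e × (∀ x → P x → ∃[ i ] e i ≡ x)

enumerate : ∀ {N} {P : Fin N → Set} → Decidable P → ∃[ m ] Enumeration P m
enumerate {zero} P? = 0 , (λ ()) , (λ ()) , (λ { {()} }) , (λ ())
enumerate {suc N} {P} P? with enumerate (P? ∘ Fin.suc) | P? fzero
... | m , e , Pe , e-inj , e-onto | no ¬P0 =
  m , Fin.suc ∘ e , Pe , e-inj ∘ Finₚ.suc-injective , onto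
  where
    onto : ∀ x → P x → ∃[ i ] Fin.suc (e i) ≡ x
    onto fzero P0 = contradiction P0 ¬P0
    onto (Fin.suc x) Px with i , ei≡x ← e-onto x Px = i , cong Fin.suc ei≡x
... | m , e , Pe , e-inj , e-onto | yes P0 = suc m , e′ , Pe′ , e′-inj , onto
  where
    e′ : Fin (suc m) → Fin (suc N)
    e′ fzero = fzero
    e′ (Fin.suc i) = Fin.suc (e i)
    Pe′ : ∀ i → P (e′ i)
    Pe′ fzero = P0
    Pe′ (Fin.suc i) = Pe i
    e′-inj : Injective _≡_ _≡_ e′
    e′-inj {fzero} {fzero} _ = refl
    e′-inj {Fin.suc i} {Fin.suc j} eq = cong Fin.suc (e-inj (Finₚ.suc-injective eq))
    onto : ∀ x → P x → ∃[ i ] e′ i ≡ x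
    onto fzero _ = fzero , refl
    onto (Fin.suc x) Px with i , ei≡x ← e-onto x Px = Fin.suc i , cong Fin.suc ei≡x

extend : ∀ {b n} → (Fin n → Fin (suc b)) → Fun b
extend {n = zero} v _ = fzero
extend {n = suc n} v zero = v fzero
extend {n = suc n} v (suc x) = extend (v ∘ Fin.suc) x

extend-toℕ : ∀ {b n} (v : Fin n → Fin (suc b)) i → extend v (toℕ i) ≡ v i
extend-toℕ v fzero = refl
extend-toℕ v (Fin.suc i) = extend-toℕ (v ∘ Fin.suc) i

extend-beyond : ∀ {b n} (v : Fin n → Fin (suc b)) x → n ≤ x → extend v x ≡ fzero
extend-beyond {n = zero} v x _ = refl
extend-beyond {n = suc n} v (suc x) (s≤s n≤x) = extend-beyond (v ∘ Fin.suc) x n≤x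

extend-restrict : ∀ {b} n (g : Fun b) x → x < n → extend {n = n} (g ∘ toℕ) x ≡ g x
extend-restrict (suc n) g zero _ = refl
extend-restrict (suc n) g (suc x) (s≤s x<n) = extend-restrict n (g ∘ suc) x x<n

extend-cong : ∀ {b n} {v w : Fin n → Fin (suc b)} → (∀ i → v i ≡ w i) → extend v ≈ extend w
extend-cong {n = zero} _ _ = refl
extend-cong {n = suc n} v≗w zero = v≗w fzero
extend-cong {n = suc n} v≗w (suc x) = extend-cong (v≗w ∘ Fin.suc) x

funToFin-cong : ∀ {m n} {v w : Fin m → Fin n} → (∀ i → v i ≡ w i) → funToFin v ≡ funToFin w
funToFin-cong {zero} _ = refl
funToFin-cong {suc m} v≗w = cong₂ combine (v≗w fzero) (funToFin-cong (v≗w ∘ Fin.suc))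

decode : ∀ {b} n → Fin (suc b ^ n) → Fun b
decode n c = extend {n = n} (finToFun c)

encode : ∀ {b} n → Fun b → Fin (suc b ^ n)
encode n g = funToFin {n} (g ∘ toℕ)

decode-bounded : ∀ {b} k (c : Fin (suc b ^ suc k)) → Bounded k (decode (suc k) c)
decode-bounded k c n = extend-beyond {n = suc k} (finToFun c) n

decode-encode : ∀ {b k} {g : Fun b} → Bounded k g → decode (suc k) (encode (suc k) g) ≈ g
decode-encode {k = k} {g} bd x with x ≤? k
... | yes x≤k = trans (extend-cong (finToFun-funToFin {suc k} (g ∘ toℕ)) x) (extend-restrict (suc k) g x (s≤s x≤k))
... | no x≰k = trans (extend-beyond {n = suc k} (finToFun (encode (suc k) g)) x (≰⇒> x≰k)) (sym (bd x (≰⇒> x≰k)))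

decode-injective : ∀ {b} n {c c' : Fin (suc b ^ n)} → decode n c ≈ decode n c' → c ≡ c'
decode-injective {b} n {c} {c'} eq = begin
  c                                  ≡⟨ funToFin-finToFin {n} {suc b} c ⟨
  funToFin (finToFun {suc b} {n} c)  ≡⟨ funToFin-cong finToFun-eq ⟩
  funToFin (finToFun {suc b} {n} c') ≡⟨ funToFin-finToFin {n} {suc b} c' ⟩
  c'                                 ∎
  where
    open ≡-Reasoning
    finToFun-eq : ∀ i → finToFun {suc b} {n} c i ≡ finToFun c' i
    finToFun-eq i = trans (sym (extend-toℕ (finToFun c) i)) (trans (eq (toℕ i)) (extend-toℕ (finToFun c') i))

_⇔-dec_ : ∀ {P Q : Set} → Dec P → Dec Q → Dec (P ⇔ Q)
P? ⇔-dec Q? = map′ (λ (to , from) → mk⇔ to from) (λ e → Equivalence.to e , Equivalence.from e)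
  ((P? →-dec Q?) ×-dec (Q? →-dec P?))

InSumset? : ∀ {b} (g h : Fun b) i n → Dec (InSumset g h i n)
InSumset? g h i n =
  map′ to from (anyUpTo? (λ x → (i ≤? toℕ (g x)) ×-dec (i ≤? toℕ (h (n ∸ x)))) (suc n))
  where
    to : ∃[ x ] (x < suc n × Level g i x × Level h i (n ∸ x)) → InSumset g h i n
    to (x , x<1+n , lg , lh) = x , n ∸ x , m+[n∸m]≡n (s≤s⁻¹ x<1+n) , lg , lh
    from : InSumset g h i n → ∃[ x ] (x < suc n × Level g i x × Level h i (n ∸ x))
    from (x , y , x+y≡n , lg , lh) =
      x , s≤s (subst (x ≤_) x+y≡n (m≤m+n x y)) , lg ,
      subst (Level h i) (trans (sym (m+n∸m≡n x y)) (cong (_∸ x) x+y≡n)) lh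

module _ {b k} {f g h : Fun b} (f-bd : Bounded k f) (g-bd : Bounded k g) (h-bd : Bounded k h) where

  private
    Agrees : ℕ → ℕ → Set
    Agrees i n = 1 ≤ i → (Level f i n ⇔ InSumset g h i n)

    Agrees? : ∀ i n → Dec (Agrees i n)
    Agrees? i n = (1 ≤? i) →-dec ((i ≤? toℕ (f n)) ⇔-dec InSumset? g h i n)

    agrees-far : ∀ i n → k + k < n → Agrees i n
    agrees-far i n k+k<n 1≤i = mk⇔
      (λ l → contradiction l (fzero⇒¬Level {g = f} 1≤i (f-bd n (≤-<-trans (m≤m+n k k) k+k<n))))
      (λ (x , y , x+y≡n , lg , lh) → contradiction
        (subst (_≤ k + k) x+y≡n (+-mono-≤ (Bounded-Level⇒≤ g-bd 1≤i lg) (Bounded-Level⇒≤ h-bd 1≤i lh)))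
        (<⇒≱ k+k<n))

  IsSum? : Dec (IsSum f g h)
  IsSum? = map′ to from (allUpTo? (λ i → allUpTo? (Agrees? i) (suc (k + k))) (suc b))
    where
      to : (∀ {i} → i < suc b → ∀ {n} → n < suc (k + k) → Agrees i n) → IsSum f g h
      to near i 1≤i i≤b n with n ≤? k + k
      ... | yes n≤2k = near (s≤s i≤b) (s≤s n≤2k) 1≤i
      ... | no n≰2k = agrees-far i n (≰⇒> n≰2k) 1≤i
      from : IsSum f g h → ∀ {i} → i < suc b → ∀ {n} → n < suc (k + k) → Agrees i n
      from S i<1+b _ 1≤i = S _ 1≤i (s≤s⁻¹ i<1+b) _

module _ {b} {f : Fun b} (k : ℕ) (f-bd : Bounded k f)
         (summands-bd : ∀ {g h} → IsSum f g h → Bounded k g × Bounded k h) where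

  private
    code : Fin (suc b ^ suc k) → Fun b
    code = decode (suc k)

    code-bd : ∀ c → Bounded k (code c)
    code-bd = decode-bounded k

    IsDivisor-code? : ∀ c → Dec (IsDivisor (code c) f)
    IsDivisor-code? c = map′ to from (any? (λ c' → IsSum? f-bd (code-bd c) (code-bd c')))
      where
        to : ∃[ c' ] IsSum f (code c) (code c') → IsDivisor (code c) f
        to (c' , S) = Bounded⇒InM (code-bd c) , code c' , Bounded⇒InM (code-bd c') , S
        from : IsDivisor (code c) f → ∃[ c' ] IsSum f (code c) (code c')
        from (_ , h , _ , S) =
          encode (suc k) h , IsSum-resp (λ _ → refl) (sym ∘ decode-encode (proj₂ (summands-bd S))) S

  countDivisors : ∃[ m ] DivisorCount f m
  countDivisors with m , e , divides , e-inj , e-onto ← enumerate IsDivisor-code?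
    = m , code ∘ e , divides , (λ i j eq → e-inj (decode-injective (suc k) eq)) , complete
    where
      complete : ∀ g → IsDivisor g f → ∃[ i ] (g ≈ code (e i))
      complete g D@(_ , _ , _ , S) =
        let g≈code : g ≈ code (encode (suc k) g)
            g≈code = sym ∘ decode-encode (proj₁ (summands-bd S))
            (i , ei≡c) = e-onto (encode (suc k) g) (IsDivisor-resp g≈code D)
        in i , λ n → trans (g≈code n) (cong (λ c → code c n) (sym ei≡c))

-- Comparing divisor counts

injective-missing⇒< : ∀ {m n} {φ : Fin m → Fin n} → Injective _≡_ _≡_ φ → (j : Fin n) → (∀ i → φ i ≢ j) → m < n
injective-missing⇒< {m} {suc n} {φ} φ-inj j φ≢j =
  s≤s (injective⇒≤ {f = φ′} (λ eq → φ-inj (punchOut-injective (φ≢j _ ∘ sym) (φ≢j _ ∘ sym) eq)))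
  where
    φ′ : Fin m → Fin n
    φ′ i = punchOut (φ≢j i ∘ sym)

module _ {b m n} {f F : Fun b} (count-f : DivisorCount f m) (count-F : DivisorCount F n)
         (φ : Fun b → Fun b) (φ-divides : ∀ {g} → IsDivisor g f → IsDivisor (φ g) F)
         (φ-injective : ∀ {g g'} → IsDivisor g f → IsDivisor g' f → φ g ≈ φ g' → g ≈ g') where

  private
    e = proj₁ count-f
    e-divides = proj₁ (proj₂ count-f)
    e-injective = proj₁ (proj₂ (proj₂ count-f))
    E = proj₁ count-F
    E-onto = proj₂ (proj₂ (proj₂ count-F))

    index : Fin m → Fin n
    index i = proj₁ (E-onto (φ (e i)) (φ-divides (e-divides i)))

    φ≈E : ∀ {i j} → index i ≡ j → φ (e i) ≈ E j
    φ≈E {i} refl = proj₂ (E-onto (φ (e i)) (φ-divides (e-divides i)))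

    index-injective : Injective _≡_ _≡_ index
    index-injective {i} {j} eq = e-injective i j (φ-injective (e-divides i) (e-divides j)
      (λ x → trans (φ≈E eq x) (sym (φ≈E refl x))))

  divisorCount-≤ : m ≤ n
  divisorCount-≤ = injective⇒≤ index-injective

  divisorCount-< : ∀ {w} → IsDivisor w F → (∀ {g} → IsDivisor g f → ¬ φ g ≈ w) → m < n
  divisorCount-< w∣F φ≉w with j , w≈Ej ← E-onto _ w∣F =
    injective-missing⇒< index-injective j (λ i eq → φ≉w (e-divides i) (λ x → trans (φ≈E eq x) (sym (w≈Ej x))))

-- Elements with set array (A, ∅, …, ∅)

module _ {b} (p : 1 ≤ b) (A : ℕ → Bool) where

  single-level₁ : ∀ {n} → A n ≡ true → Level (single p A) 1 n
  single-level₁ {n} An rewrite An = ≤-reflexive (sym (Finₚ.toℕ-fromℕ< (s≤s p)))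

  single-level₁⁻ : ∀ {n} → Level (single p A) 1 n → A n ≡ true
  single-level₁⁻ {n} l with A n
  ... | true = refl

  single-level≥2 : ∀ {i n} → 2 ≤ i → ¬ Level (single p A) i n
  single-level≥2 {i} {n} 2≤i l with A n
  ... | true = <⇒≱ (≤-trans 2≤i l) (≤-reflexive (Finₚ.toℕ-fromℕ< (s≤s p)))
  ... | false = contradiction (≤-trans 2≤i l) λ ()

  single-off : ∀ {n} → A n ≡ false → single p A n ≡ fzero
  single-off An rewrite An = refl

≤ᵇ-true : ∀ {n k} → n ≤ k → (n ≤ᵇ k) ≡ true
≤ᵇ-true n≤k = Equivalence.to T-≡ (≤⇒≤ᵇ n≤k)

≤ᵇ-false : ∀ {n k} → k < n → (n ≤ᵇ k) ≡ false
≤ᵇ-false {n} {k} k<n = ¬-not (λ eq → <⇒≱ k<n (≤ᵇ⇒≤ n k (Equivalence.from T-≡ eq)))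

module _ {b} (p : 1 ≤ b) where

  interval-level₁ : ∀ {k n} → n ≤ k → Level (interval p k) 1 n
  interval-level₁ {k} {n} n≤k = single-level₁ p (_≤ᵇ k) {n} (≤ᵇ-true n≤k)

  interval-level₁⁻ : ∀ {k n} → Level (interval p k) 1 n → n ≤ k
  interval-level₁⁻ {k} {n} l = ≤ᵇ⇒≤ n k (Equivalence.from T-≡ (single-level₁⁻ p (_≤ᵇ k) {n} l))

  interval-bounded : ∀ k → Bounded k (interval p k)
  interval-bounded k n k<n = single-off p (_≤ᵇ k) {n} (≤ᵇ-false k<n)

  sum-interval : ∀ {G : Fun b} {M k} → M ≤ k → Bounded M G →
                 (∀ {n} → n ≤ k → ∃[ x ] (x ≤ n × n ∸ x ≤ k ∸ M × Level G 1 x)) →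
                 IsSum (interval p k) G (interval p (k ∸ M))
  sum-interval {G} {M} {k} M≤k G-bd dense i 1≤i i≤b n with m≤n⇒m<n∨m≡n 1≤i
  ... | inj₁ 2≤i = mk⇔ (λ l → contradiction l (single-level≥2 p (_≤ᵇ k) {n = n} 2≤i))
                       (λ (_ , y , _ , _ , l) → contradiction l (single-level≥2 p (_≤ᵇ k ∸ M) {n = y} 2≤i))
  ... | inj₂ refl = mk⇔ to from
    where
      to : Level (interval p k) 1 n → InSumset G (interval p (k ∸ M)) 1 n
      to l with x , x≤n , n∸x≤k∸M , Gx ← dense (interval-level₁⁻ l) =
        x , n ∸ x , m+[n∸m]≡n x≤n , Gx , interval-level₁ n∸x≤k∸M
      from : InSumset G (interval p (k ∸ M)) 1 n → Level (interval p k) 1 n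
      from (x , y , x+y≡n , Gx , l) = interval-level₁ (begin
        n           ≡⟨ x+y≡n ⟨
        x + y       ≤⟨ +-mono-≤ (Bounded-Level⇒≤ G-bd 1≤i Gx) (interval-level₁⁻ l) ⟩
        M + (k ∸ M) ≡⟨ m+[n∸m]≡n M≤k ⟩
        k           ∎)
        where open ≤-Reasoning

  interval-divides : ∀ {j k} → j ≤ k → IsDivisor (interval p j) (interval p k)
  interval-divides {j} {k} j≤k =
    Bounded⇒InM (interval-bounded j) , interval p (k ∸ j) , Bounded⇒InM (interval-bounded (k ∸ j)) ,
    sum-interval j≤k (interval-bounded j) dense
    where
      dense : ∀ {n} → n ≤ k → ∃[ x ] (x ≤ n × n ∸ x ≤ k ∸ j × Level (interval p j) 1 x)
      dense {n} n≤k with n ≤? j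
      ... | yes n≤j = n , ≤-refl , subst (_≤ k ∸ j) (sym (n∸n≡0 n)) z≤n , interval-level₁ n≤j
      ... | no n≰j = j , <⇒≤ (≰⇒> n≰j) , ∸-monoˡ-≤ j n≤k , interval-level₁ {j} ≤-refl

-- top g n = max (supp g ∩ [0, n]), and 0 when that set is empty.

top : ∀ {b} → Fun b → ℕ → ℕ
top g zero = zero
top g (suc n) with g (suc n)
... | fzero = top g n
... | Fin.suc _ = suc n

top-≤ : ∀ {b} (g : Fun b) n → top g n ≤ n
top-≤ g zero = z≤n
top-≤ g (suc n) with g (suc n)
... | fzero = m≤n⇒m≤1+n (top-≤ g n)
... | Fin.suc _ = ≤-refl

top-level : ∀ {b} {g : Fun b} → Level g 1 0 → ∀ n → Level g 1 (top g n)
top-level g0 zero = g0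
top-level {g = g} g0 (suc n) with g (suc n) in eq
... | fzero = top-level {g = g} g0 n
... | Fin.suc _ = subst (λ v → 1 ≤ toℕ v) (sym eq) (s≤s z≤n)

top-greatest : ∀ {b} {g : Fun b} {x} n → x ≤ n → Level g 1 x → x ≤ top g n
top-greatest zero z≤n _ = z≤n
top-greatest {g = g} {x} (suc n) x≤1+n gx with g (suc n) in eq
... | Fin.suc _ = x≤1+n
... | fzero with m≤n⇒m<n∨m≡n x≤1+n
...   | inj₁ x<1+n = top-greatest n (s≤s⁻¹ x<1+n) gx
...   | inj₂ refl = contradiction gx (fzero⇒¬Level {g = g} (s≤s z≤n) eq)

module SingleSet {b} (p : 1 ≤ b) (k : ℕ) (A : ℕ → Bool) (0∈A : A 0 ≡ true)
                 (A⊆[k] : ∀ n → A n ≡ true → n ≤ k) where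

  f : Fun b
  f = single p A

  A-off : ∀ {n} → k < n → A n ≡ false
  A-off {n} k<n = ¬-not (λ An → <⇒≱ k<n (A⊆[k] n An))

  f-bounded : Bounded k f
  f-bounded n k<n = single-off p A {n} (A-off k<n)

  module Summands {g h : Fun b} (S : IsSum f g h) where

    sum-level₁ : ∀ n → Level f 1 n ⇔ InSumset g h 1 n
    sum-level₁ = S 1 ≤-refl p

    occupied-0 : Level g 1 0 × Level h 1 0
    occupied-0 with x , y , x+y≡0 , gx , hy ← Equivalence.to (sum-level₁ 0) (single-level₁ p A {0} 0∈A) =
      subst (Level g 1) (m+n≡0⇒m≡0 x x+y≡0) gx , subst (Level h 1) (m+n≡0⇒n≡0 x x+y≡0) hy

    sum-in-A : ∀ {x y} → Level g 1 x → Level h 1 y → A (x + y) ≡ true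
    sum-in-A {x} {y} gx hy = single-level₁⁻ p A (Equivalence.from (sum-level₁ (x + y)) (x , y , refl , gx , hy))

    g⊆A : ∀ {x} → Level g 1 x → A x ≡ true
    g⊆A {x} gx = subst (λ z → A z ≡ true) (+-identityʳ x) (sum-in-A gx (proj₂ occupied-0))

    h⊆A : ∀ {y} → Level h 1 y → A y ≡ true
    h⊆A = sum-in-A (proj₁ occupied-0)

    g-off-A : ∀ {x} → A x ≡ false → g x ≡ fzero
    g-off-A {x} Ax = 1≰toℕ⇒fzero (g x) (λ gx → contradiction (trans (sym Ax) (g⊆A gx)) λ ())

    g-bounded : Bounded k g
    g-bounded x k<x = g-off-A (A-off k<x)

    h-bounded : Bounded k h
    h-bounded y k<y = 1≰toℕ⇒fzero (h y) (λ hy → <⇒≱ k<y (A⊆[k] y (h⊆A hy)))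

  countDivisors-f : ∃[ m ] DivisorCount f m
  countDivisors-f = countDivisors k f-bounded (λ S → Summands.g-bounded S , Summands.h-bounded S)

  fill : Fun b → Fun b
  fill g n = if A n then g n else interval p (top g k) n

  module Fill {g h : Fun b} (S : IsSum f g h) where
    open Summands S

    m : ℕ
    m = top g k

    m-level : Level g 1 m
    m-level = top-level {g = g} (proj₁ occupied-0) k

    m∈A : A m ≡ true
    m∈A = g⊆A m-level

    fill-on : ∀ {n} → A n ≡ true → fill g n ≡ g n
    fill-on An rewrite An = refl

    fill-off : ∀ {n} → A n ≡ false → fill g n ≡ interval p m n
    fill-off An rewrite An = refl

    fill-level : ∀ {x} → Level g 1 x → Level (fill g) 1 x
    fill-level gx = subst (λ v → 1 ≤ toℕ v) (sym (fill-on (g⊆A gx))) gx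

    fill-bounded : Bounded m (fill g)
    fill-bounded n m<n with A n in An
    ... | true = 1≰toℕ⇒fzero (g n) (λ gn → <⇒≱ m<n (top-greatest k (A⊆[k] n An) gn))
    ... | false = interval-bounded p m n m<n

    cofactor-≤ : ∀ {y} → Level h 1 y → y ≤ k ∸ m
    cofactor-≤ {y} hy = m+n≤o⇒m≤o∸n y (subst (_≤ k) (+-comm m y) (A⊆[k] (m + y) (sum-in-A m-level hy)))

    fill-dense : ∀ {n} → n ≤ k → ∃[ x ] (x ≤ n × n ∸ x ≤ k ∸ m × Level (fill g) 1 x)
    fill-dense {n} n≤k with A n in An
    ... | true with x , y , x+y≡n , gx , hy ← Equivalence.to (sum-level₁ n) (single-level₁ p A {n} An) =
      x , subst (x ≤_) x+y≡n (m≤m+n x y) ,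
      subst (_≤ k ∸ m) (trans (sym (m+n∸m≡n x y)) (cong (_∸ x) x+y≡n)) (cofactor-≤ hy) , fill-level gx
    ... | false with n ≤? m
    ...   | yes n≤m = n , ≤-refl , subst (_≤ k ∸ m) (sym (n∸n≡0 n)) z≤n ,
                      subst (λ v → 1 ≤ toℕ v) (sym (fill-off An)) (interval-level₁ p n≤m)
    ...   | no n≰m = m , <⇒≤ (≰⇒> n≰m) , ∸-monoˡ-≤ m n≤k , fill-level m-level

    fill-divides : IsDivisor (fill g) (interval p k)
    fill-divides = Bounded⇒InM fill-bounded , interval p (k ∸ m) , Bounded⇒InM (interval-bounded p (k ∸ m)) ,
                   sum-interval p (top-≤ g k) fill-bounded fill-dense

    fill-misses : ∀ {j} → A j ≡ false → ¬ fill g ≈ interval p j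
    fill-misses {j} Aj fill≈[j] = contradiction (trans (sym Aj) (subst (λ x → A x ≡ true) m≡j m∈A)) λ ()
      where
        m≤j : m ≤ j
        m≤j = interval-level₁⁻ p (Level-resp fill≈[j] (fill-level m-level))
        j≤m : j ≤ m
        j≤m = interval-level₁⁻ p (subst (λ v → 1 ≤ toℕ v) (fill-off Aj)
                (Level-resp (sym ∘ fill≈[j]) (interval-level₁ p {j} ≤-refl)))
        m≡j : m ≡ j
        m≡j = ≤-antisym m≤j j≤m

  fill-divides : ∀ {g} → IsDivisor g f → IsDivisor (fill g) (interval p k)
  fill-divides (_ , _ , _ , S) = Fill.fill-divides S

  fill-misses : ∀ {j g} → A j ≡ false → IsDivisor g f → ¬ fill g ≈ interval p j
  fill-misses Aj (_ , _ , _ , S) = Fill.fill-misses S Aj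

  fill-injective : ∀ {g g'} → IsDivisor g f → IsDivisor g' f → fill g ≈ fill g' → g ≈ g'
  fill-injective {g} {g'} (_ , _ , _ , S) (_ , _ , _ , S') fill≈fill n with A n in An
  ... | true = begin
    g n       ≡⟨ Fill.fill-on S An ⟨
    fill g n  ≡⟨ fill≈fill n ⟩
    fill g' n ≡⟨ Fill.fill-on S' An ⟩
    g' n      ∎
    where open ≡-Reasoning
  ... | false = trans (Summands.g-off-A S An) (sym (Summands.g-off-A S' An))

  missing-point : ¬ f ≈ interval p k → ∃[ j ] (j ≤ k × A j ≡ false)
  missing-point f≉[k] with anyUpTo? (λ j → A j ≟ᵇ false) (suc k)
  ... | yes (j , j<1+k , Aj) = j , s≤s⁻¹ j<1+k , Aj
  ... | no none = contradiction (λ n → cong (λ β → if β then one p else fzero) (A≡≤ᵇ n)) f≉[k]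
    where
      A≡≤ᵇ : ∀ n → A n ≡ (n ≤ᵇ k)
      A≡≤ᵇ n with n ≤? k
      ... | yes n≤k = trans (¬-not (λ An → none (n , s≤s n≤k , An))) (sym (≤ᵇ-true n≤k))
      ... | no n≰k = trans (A-off (≰⇒> n≰k)) (sym (≤ᵇ-false (≰⇒> n≰k)))

mainTheorem20 : (b k : ℕ) (p : 1 ≤ b) (A : ℕ → Bool) →
    A 0 ≡ true → (∀ n → A n ≡ true → n ≤ k) →
    ∃[ m ] ∃[ n ] (DivisorCount (single p A) m × DivisorCount (interval p k) n ×
      m ≤ n × (¬ (single p A ≈ interval p k) → m < n))
mainTheorem20 b k p A 0∈A A⊆[k]
  with m , count-f ← SingleSet.countDivisors-f p k A 0∈A A⊆[k]
     | n , count-[k] ← SingleSet.countDivisors-f p k (_≤ᵇ k) refl (λ n → ≤ᵇ⇒≤ n k ∘ Equivalence.from T-≡)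
  = m , n , count-f , count-[k] , divisorCount-≤ count-f count-[k] fill fill-divides fill-injective , strict
  where
    open SingleSet p k A 0∈A A⊆[k]
    strict : ¬ f ≈ interval p k → m < n
    strict f≉[k] with j , j≤k , Aj ← missing-point f≉[k] =
      divisorCount-< count-f count-[k] fill fill-divides fill-injective (interval-divides p j≤k) (fill-misses Aj)
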